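{- Let $m\ge0$ and let $\pi\in S_m$ be a straight ménage permutation. For $n\ge0$ let $w_m^n$ be the number of permutations $\tau\in S_{m+n}$ that can be reduced to $\pi$ by a finite sequence of reductions of type 1 and type 2. Then \[ \sum_{n\ge0}w_m^nx^n=c(x)^{2m+1}, \] where $c(x)=\sum_{k\ge0}C_kx^k$ is the generating function of the Catalan numbers $C_k=\frac{(2k)!}{k!\,(k+1)!}$. (In particular $w_m^n$ depends only on $m$ and $n$.)
   Context: $S_n$ is the symmetric group on $[n]=\{1,\dots,n\}$, and $S_0=\{\pi_\emptyset\}$ consists of the empty permutation. For $m\ge1$, $\pi\in S_m$ is a straight ménage permutation if $\pi(i)\ne i$ and $\pi(i)\ne i+1$ for all $i$; by convention $\pi_\emptyset$ is a straight ménage permutation. Reduction of type 1: if $n\ge1$, $\pi\in S_n$ and $\pi(i)=i$, the reduced permutation is $\pi_\emptyset$ if $n=1$, and for $n>1$ it is $\pi'\in S_{n-1}$ with $\pi'(j)=\psi(\pi(\sigma(j)))$, where $\sigma(j)=j$ for $j<i$, $\sigma(j)=j+1$ for $j\ge i$, and $\psi(k)=k$ for $k<i$, $\psi(k)=k-1$ for $k>i$. Reduction of type 2: if $n\ge2$, $\pi\in S_n$ and $\pi(i)=i+1$, the reduced permutation is $\pi'\in S_{n-1}$ with $\pi'(j)=\varphi(\pi(\sigma(j)))$, where $\sigma$ is as before and $\varphi(k)=k$ for $k\le i$, $\varphi(k)=k-1$ for $k>i+1$. "$\tau$ can be reduced to $\pi$" means there is a sequence $\tau=\tau_0,\tau_1,\dots,\tau_\ell=\pi$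 ($\ell\ge0$) with each $\tau_{s+1}$ obtained from $\tau_s$ by one such reduction. -}

module Defs where

open import Data.Nat using (ℕ; zero; suc; _+_; _*_; _∸_; _<_; _≤_; _<ᵇ_; _≤ᵇ_; _!)
open import Data.Nat.Properties using (_!*_!≢0)
open import Data.Nat.DivMod using (_/_)
open import Data.Bool using (if_then_else_)
open import Data.Fin using (Fin; toℕ; punchIn)
open import Data.Vec using (Vec; lookup; tabulate; map)
open import Data.List using (List; length)
open import Data.List.Membership.Propositional using (_∈_)
open import Data.List.Relation.Unary.Unique.Propositional using (Unique)
open import Data.Product using (_×_; Σ; ∃)
open import Function.Bundles using (_⇔_)
open import Relation.Binary.PropositionalEquality using (_≡_; _≢_)

-- Permutations of [k], in one-line notation, 0-based:
-- position j ∈ Fin k holds the value π(j+1) - 1 ∈ {0,…,k-1}.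
-- (Conditions "π(i)=i" and "π(i)=i+1" are invariant under this shift.)

IsPerm : ∀ {k} → Vec ℕ k → Set
IsPerm {k} τ = (∀ j → lookup τ j < k) × (∀ j j' → lookup τ j ≡ lookup τ j' → j ≡ j')

Perm : ℕ → Set
Perm k = Σ (Vec ℕ k) IsPerm

IsStraightMenage : ∀ {k} → Vec ℕ k → Set
IsStraightMenage π = IsPerm π × (∀ j → (lookup π j ≢ toℕ j) × (lookup π j ≢ suc (toℕ j)))

dropAt : ∀ {k} → Vec ℕ (suc k) → Fin (suc k) → Vec ℕ k
dropAt τ i = tabulate (λ j → lookup τ (punchIn i j))

ψ : ℕ → ℕ → ℕ
ψ i v = if v <ᵇ i then v else v ∸ 1

φ : ℕ → ℕ → ℕ
φ i v = if v ≤ᵇ i then v else v ∸ 1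

data Step : ∀ {k} → Vec ℕ (suc k) → Vec ℕ k → Set where
  type1 : ∀ {k} (τ : Vec ℕ (suc k)) (i : Fin (suc k)) →
          lookup τ i ≡ toℕ i →
          Step τ (map (ψ (toℕ i)) (dropAt τ i))
  type2 : ∀ {k} (τ : Vec ℕ (suc (suc k))) (i : Fin (suc (suc k))) →
          lookup τ i ≡ suc (toℕ i) →
          Step τ (map (φ (toℕ i)) (dropAt τ i))

data ReducesTo : ∀ {a b} → Vec ℕ a → Vec ℕ b → Set where
  done : ∀ {a} {τ : Vec ℕ a} → ReducesTo τ τ
  step : ∀ {k b} {τ : Vec ℕ (suc k)} {τ' : Vec ℕ k} {π : Vec ℕ b} →
         Step τ τ' → ReducesTo τ' π → ReducesTo τ π

-- Cardinality: the set {τ ∈ S_k | P τ} has exactly N elements, witnessed by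
-- a duplicate-free list of exactly its members.
HasCard : ∀ {k} → (Vec ℕ k → Set) → ℕ → Set
HasCard {k} P N =
  ∃ λ (L : List (Vec ℕ k)) →
    Unique L × (∀ τ → (τ ∈ L) ⇔ (IsPerm τ × P τ)) × (length L ≡ N)

catalan : ℕ → ℕ
catalan k = ((2 * k) !  / (k ! * (suc k) !)) {{k !* suc k !≢0}}

-- Formal power series as coefficient sequences; product = Cauchy convolution.
sumTo : ℕ → (ℕ → ℕ) → ℕ
sumTo zero    f = f 0
sumTo (suc n) f = sumTo n f + f (suc n)

conv : (ℕ → ℕ) → (ℕ → ℕ) → ℕ → ℕ
conv f g n = sumTo n (λ i → f i * g (n ∸ i))

one : ℕ → ℕ
one zero    = 1
one (suc _) = 0

pow : (ℕ → ℕ) → ℕ → ℕ → ℕ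
pow f zero    = one
pow f (suc e) = conv f (pow f e)

-- A position x of τ with τ(x) ∈ {x, x+1} is an arc; the
-- reductions of type 1 and 2 are exactly deletions of arcs.
-- (1) Confluence: arc deletions commute (a diamond lemma), so if τ reduces to
--     the arc-free π, then so does τ with ANY arc deleted.
-- (2) Generating tree: encode an arc (x, c) by g = x + c.  Deleting the first
--     arc of τ gives a parent τ′, from which τ is the child obtained by
--     inserting arc number g; the admissible g are those below slots τ′ =
--     x′ + c′ + 2 for the first arc (x′, c′) of τ′ (2k + 1 if there is none).
--     The root π has 2m + 1 slots, and a node with s slots has children with
--     2, …, s + 1 slots.
-- (3) Counting: the number ballot n s of descendants n levels below a node
--     with s slots obeys the ballot recursion, and ∑ₙ ballot n s xⁿ = c(x)ˢ.
module Submission where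

open import Defs
open import Data.Nat
open import Data.Nat.Properties
open import Data.Nat.Combinatorics
  using (_C_; nCk+nC[k+1]≡[n+1]C[k+1]; nCk≡nC[n∸k]; nCk≡n!/k![n-k]!; k![n∸k]!∣n!)
open import Data.Nat.DivMod using (_/_; m/n*n≡m; m*n/n≡m)
open import Data.Nat.Tactic.RingSolver using (solve-∀)
open import Data.Nat.ListAction using (sum)
open import Data.Nat.ListAction.Properties using (sum-++)
open import Data.Bool using (true; false; if_then_else_)
open import Data.Fin as F using (Fin; toℕ; punchIn; fromℕ<)
import Data.Fin.Properties as FinP
open import Data.Vec as V using (Vec; lookup; tabulate; insertAt; _∷_; [])
import Data.Vec.Properties as VecP
open import Data.List using (List; []; _∷_; _++_; _∷ʳ_; map; concatMap; upTo; length)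
open import Data.List.Properties using (map-++; map-∘; map-cong-local; upTo-∷ʳ)
open import Data.List.Membership.Propositional using (_∈_; find; lose)
open import Data.List.Membership.Propositional.Properties
  using (∈-map⁺; ∈-map⁻; ∈-concatMap⁺; ∈-concatMap⁻; ∈-upTo⁺; ∈-upTo⁻)
open import Data.List.Relation.Unary.Any using (here; there)
import Data.List.Relation.Unary.All as All
open import Data.List.Relation.Unary.AllPairs using ([]; _∷_)
open import Data.List.Relation.Unary.Unique.Propositional using (Unique)
open import Data.List.Relation.Unary.Unique.Propositional.Properties using (++⁺; upTo⁺)
open import Data.Product using (Σ; _×_; _,_; proj₁; proj₂)
open import Data.Sum as Sum using (_⊎_; inj₁; inj₂; [_,_])
open import Data.Empty using (⊥-elim)
open import Function.Bundles using (_⇔_; mk⇔)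
open import Relation.Nullary using (¬_; Dec; yes; no)
open import Relation.Nullary.Decidable using (_⊎-dec_)
open import Relation.Binary.PropositionalEquality hiding ([_])
open import Relation.Binary.Definitions using (tri<; tri≈; tri>)

-- Ballot numbers and the Catalan series.

-- ballot n s is the number of descendants n generations below a node with
-- s children, in the tree where the g-th child (g < s) of any node has g + 2
-- children.  It is the coefficient of xⁿ in c(x)ˢ (proved below).
ballot : ℕ → ℕ → ℕ
ballot zero    s       = 1
ballot (suc n) zero    = 0
ballot (suc n) (suc s) = ballot (suc n) s + ballot n (suc (suc s))

sumTo-cong : ∀ n {f g : ℕ → ℕ} → (∀ i → f i ≡ g i) → sumTo n f ≡ sumTo n g
sumTo-cong zero    f≗g = f≗g 0
sumTo-cong (suc n) f≗g = cong₂ _+_ (sumTo-cong n f≗g) (f≗g (suc n))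

sumTo-first : ∀ n (f : ℕ → ℕ) → sumTo (suc n) f ≡ f 0 + sumTo n (λ i → f (suc i))
sumTo-first zero    f = refl
sumTo-first (suc n) f = begin
  sumTo (suc n) f + f (suc (suc n))                    ≡⟨ cong (_+ f (suc (suc n))) (sumTo-first n f) ⟩
  f 0 + sumTo n (λ i → f (suc i)) + f (suc (suc n))    ≡⟨ +-assoc (f 0) _ _ ⟩
  f 0 + (sumTo n (λ i → f (suc i)) + f (suc (suc n)))  ∎
  where open ≡-Reasoning

sumTo-+ : ∀ n (f g : ℕ → ℕ) → sumTo n (λ i → f i + g i) ≡ sumTo n f + sumTo n g
sumTo-+ zero    f g = refl
sumTo-+ (suc n) f g = begin
  sumTo n (λ i → f i + g i) + (f (suc n) + g (suc n)) ≡⟨ cong (_+ (f (suc n) + g (suc n))) (sumTo-+ n f g) ⟩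
  sumTo n f + sumTo n g + (f (suc n) + g (suc n))     ≡⟨ interchange (sumTo n f) (sumTo n g) (f (suc n)) (g (suc n)) ⟩
  sumTo n f + f (suc n) + (sumTo n g + g (suc n))     ∎
  where
  open ≡-Reasoning
  interchange : ∀ a b c d → a + b + (c + d) ≡ a + c + (b + d)
  interchange = solve-∀

-- ballot i 0 is the unit series, so convolving with it changes nothing.
ballot-zero-convolution : ∀ n b → conv (λ i → ballot i 0) (λ i → ballot i b) n ≡ ballot n b
ballot-zero-convolution zero    b = +-identityʳ (ballot 0 b)
ballot-zero-convolution (suc n) b = begin
  sumTo (suc n) (λ i → ballot i 0 * ballot (suc n ∸ i) b)   ≡⟨ sumTo-first n _ ⟩
  ballot (suc n) b + 0 + sumTo n (λ i → 0)                  ≡⟨ cong (ballot (suc n) b + 0 +_) (sumTo-zero n) ⟩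
  ballot (suc n) b + 0 + 0                                  ≡⟨ +-identityʳ _ ⟩
  ballot (suc n) b + 0                                      ≡⟨ +-identityʳ _ ⟩
  ballot (suc n) b                                          ∎
  where
  open ≡-Reasoning
  sumTo-zero : ∀ n → sumTo n (λ i → 0) ≡ 0
  sumTo-zero zero    = refl
  sumTo-zero (suc n) = cong (_+ 0) (sumTo-zero n)

ballot-convolution : ∀ n a b → conv (λ i → ballot i a) (λ i → ballot i b) n ≡ ballot n (a + b)
ballot-convolution n       zero    b = ballot-zero-convolution n b
ballot-convolution zero    (suc a) b = refl
ballot-convolution (suc n) (suc a) b = begin
  sumTo (suc n) (λ i → ballot i (suc a) * ballot (suc n ∸ i) b)  ≡⟨ sumTo-first n _ ⟩
  1 * ballot (suc n) b + sumTo n (λ j → (ballot (suc j) a + ballot j (suc (suc a))) * ballot (n ∸ j) b)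
    ≡⟨ cong (1 * ballot (suc n) b +_) split ⟩
  1 * ballot (suc n) b + (S₁ + S₂)                              ≡⟨ +-assoc (1 * ballot (suc n) b) S₁ S₂ ⟨
  (1 * ballot (suc n) b + S₁) + S₂                              ≡⟨ cong (_+ S₂) (sumTo-first n _) ⟨
  sumTo (suc n) (λ i → ballot i a * ballot (suc n ∸ i) b) + S₂
    ≡⟨ cong₂ _+_ (ballot-convolution (suc n) a b) (ballot-convolution n (suc (suc a)) b) ⟩
  ballot (suc n) (a + b) + ballot n (suc (suc a) + b)            ∎
  where
  open ≡-Reasoning
  S₁ = sumTo n (λ j → ballot (suc j) a * ballot (n ∸ j) b)
  S₂ = sumTo n (λ j → ballot j (suc (suc a)) * ballot (n ∸ j) b)
  split : sumTo n (λ j → (ballot (suc j) a + ballot j (suc (suc a))) * ballot (n ∸ j) b) ≡ S₁ + S₂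
  split = trans (sumTo-cong n (λ j → *-distribʳ-+ (ballot (n ∸ j) b) (ballot (suc j) a) _))
                (sumTo-+ n _ _)

-- The lower binomial of the ballot formula: binomBelow n t = (2n+t) C (n-1).
binomBelow : ℕ → ℕ → ℕ
binomBelow zero    t = 0
binomBelow (suc n) t = (suc n + suc n + t) C n

pascal-below : ∀ n t → suc (n + n + t) C n ≡ binomBelow n t + (n + n + t) C n
pascal-below zero    t = refl
pascal-below (suc n) t = sym (nCk+nC[k+1]≡[n+1]C[k+1] (suc n + suc n + t) n)

middle-symmetry : ∀ n → (n + n + 1) C suc n ≡ (n + n + 1) C n
middle-symmetry n = begin
  (n + n + 1) C suc n                ≡⟨ nCk≡nC[n∸k] (subst (suc n ≤_) (sym 2n+1≡) (m≤m+n (suc n) n)) ⟩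
  (n + n + 1) C (n + n + 1 ∸ suc n)  ≡⟨ cong (λ k → (n + n + 1) C (k ∸ suc n)) 2n+1≡ ⟩
  (n + n + 1) C (suc n + n ∸ suc n)  ≡⟨ cong ((n + n + 1) C_) (m+n∸m≡n (suc n) n) ⟩
  (n + n + 1) C n                    ∎
  where
  open ≡-Reasoning
  2n+1≡ : n + n + 1 ≡ suc n + n
  2n+1≡ = +-comm (n + n) 1

-- The ballot formula  ballot n (t+1) = (2n+t) C n − (2n+t) C (n−1),
-- proved by induction along the defining recursion of ballot.
ballot-formula : ∀ n t → ballot n (suc t) + binomBelow n t ≡ (n + n + t) C n
ballot-formula zero    t       = refl
ballot-formula (suc n) zero    = begin
  ballot n 2 + (suc n + suc n + 0) C n        ≡⟨ cong (λ k → ballot n 2 + k C n) (size n) ⟩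
  ballot n 2 + suc N C n                      ≡⟨ cong (ballot n 2 +_) (pascal-below n 1) ⟩
  ballot n 2 + (binomBelow n 1 + N C n)       ≡⟨ +-assoc (ballot n 2) _ _ ⟨
  (ballot n 2 + binomBelow n 1) + N C n       ≡⟨ cong (_+ N C n) (ballot-formula n 1) ⟩
  N C n + N C n                               ≡⟨ cong (N C n +_) (middle-symmetry n) ⟨
  N C n + N C suc n                           ≡⟨ nCk+nC[k+1]≡[n+1]C[k+1] N n ⟩
  suc N C suc n                               ≡⟨ cong (_C suc n) (size n) ⟨
  (suc n + suc n + 0) C suc n                 ∎
  where
  open ≡-Reasoning
  N = n + n + 1
  size : ∀ n → suc n + suc n + 0 ≡ suc (n + n + 1)
  size = solve-∀
ballot-formula (suc n) (suc t) = begin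
  (B₁ + B₂) + (suc n + suc n + suc t) C n              ≡⟨ cong (λ k → (B₁ + B₂) + k C n) (size₁ n t) ⟩
  (B₁ + B₂) + suc (n + n + (2 + t)) C n                ≡⟨ cong ((B₁ + B₂) +_) (pascal-below n (2 + t)) ⟩
  (B₁ + B₂) + (binomBelow n (2 + t) + (n + n + (2 + t)) C n)
    ≡⟨ cong (λ k → (B₁ + B₂) + (binomBelow n (2 + t) + k C n)) (size₂ n t) ⟩
  (B₁ + B₂) + (binomBelow n (2 + t) + M C n)           ≡⟨ regroup B₁ B₂ (binomBelow n (2 + t)) (M C n) ⟩
  (B₁ + M C n) + (B₂ + binomBelow n (2 + t))
    ≡⟨ cong₂ _+_ (ballot-formula (suc n) t) (trans (ballot-formula n (2 + t)) (cong (_C n) (size₂ n t))) ⟩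
  M C suc n + M C n                                    ≡⟨ +-comm (M C suc n) (M C n) ⟩
  M C n + M C suc n                                    ≡⟨ nCk+nC[k+1]≡[n+1]C[k+1] M n ⟩
  suc M C suc n                                        ≡⟨ cong (_C suc n) (+-suc (suc n + suc n) t) ⟨
  (suc n + suc n + suc t) C suc n                      ∎
  where
  open ≡-Reasoning
  B₁ = ballot (suc n) (suc t)
  B₂ = ballot n (suc (suc (suc t)))
  M = suc n + suc n + t
  size₁ : ∀ n t → suc n + suc n + suc t ≡ suc (n + n + (2 + t))
  size₁ = solve-∀
  size₂ : ∀ n t → n + n + (2 + t) ≡ suc n + suc n + t
  size₂ = solve-∀
  regroup : ∀ a b c d → (a + b) + (c + d) ≡ (a + d) + (b + c)
  regroup = solve-∀

binomial-factorials : ∀ N k → k ≤ N → (N C k) * (k ! * (N ∸ k) !) ≡ N !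
binomial-factorials N k k≤N =
  trans (cong (_* (k ! * (N ∸ k) !)) (nCk≡n!/k![n-k]! k≤N)) (m/n*n≡m (k![n∸k]!∣n! k≤N))
  where instance _ = k !* (N ∸ k) !≢0

below-factorials : ∀ n → binomBelow n 0 * (n ! * suc n !) ≡ (n + n) ! * n
below-factorials zero    = refl
below-factorials (suc k) = begin
  (N C k) * ((suc k * k !) * suc (suc k) !)  ≡⟨ regroup (N C k) k (k !) (suc (suc k) !) ⟩
  suc k * ((N C k) * (k ! * suc (suc k) !))  ≡⟨ cong (λ j → suc k * ((N C k) * (k ! * j !))) rest ⟨
  suc k * ((N C k) * (k ! * (N ∸ k) !))      ≡⟨ cong (suc k *_) (binomial-factorials N k k≤N) ⟩
  suc k * N !                                ≡⟨ cong (λ j → suc k * j !) (+-identityʳ (suc k + suc k)) ⟩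
  suc k * (suc k + suc k) !                  ≡⟨ *-comm (suc k) _ ⟩
  (suc k + suc k) ! * suc k                  ∎
  where
  open ≡-Reasoning
  N = suc k + suc k + 0
  split : ∀ k → suc k + suc k + 0 ≡ k + suc (suc k)
  split = solve-∀
  regroup : ∀ c k a b → c * ((suc k * a) * b) ≡ suc k * (c * (a * b))
  regroup = solve-∀
  rest : N ∸ k ≡ suc (suc k)
  rest = trans (cong (_∸ k) (split k)) (m+n∸m≡n k (suc (suc k)))
  k≤N : k ≤ N
  k≤N = subst (k ≤_) (sym (split k)) (m≤m+n k (suc (suc k)))

central-factorials : ∀ n → ((n + n + 0) C n) * (n ! * suc n !) ≡ (n + n) ! * suc n
central-factorials n = begin
  ((n + n + 0) C n) * (n ! * (suc n * n !))        ≡⟨ regroup ((n + n + 0) C n) (n !) (suc n) ⟩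
  (((n + n + 0) C n) * (n ! * n !)) * suc n        ≡⟨ cong (λ j → ((j C n) * (n ! * n !)) * suc n) (+-identityʳ (n + n)) ⟩
  (((n + n) C n) * (n ! * n !)) * suc n            ≡⟨ cong (λ j → (((n + n) C n) * (n ! * j !)) * suc n) (m+n∸m≡n n n) ⟨
  (((n + n) C n) * (n ! * (n + n ∸ n) !)) * suc n  ≡⟨ cong (_* suc n) (binomial-factorials (n + n) n (m≤m+n n n)) ⟩
  (n + n) ! * suc n                                ∎
  where
  open ≡-Reasoning
  regroup : ∀ c a b → c * (a * (b * a)) ≡ (c * (a * a)) * b
  regroup = solve-∀

-- ballot n 1 · n! (n+1)! = (2n)!: the ballot formula at t = 0 is the Catalan number.
ballot-one-factorials : ∀ n → ballot n 1 * (n ! * suc n !) ≡ (n + n) !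
ballot-one-factorials n = +-cancelʳ-≡ ((n + n) ! * n) _ _ (begin
  ballot n 1 * F + (n + n) ! * n       ≡⟨ cong (ballot n 1 * F +_) (below-factorials n) ⟨
  ballot n 1 * F + binomBelow n 0 * F  ≡⟨ *-distribʳ-+ F (ballot n 1) (binomBelow n 0) ⟨
  (ballot n 1 + binomBelow n 0) * F    ≡⟨ cong (_* F) (ballot-formula n 0) ⟩
  ((n + n + 0) C n) * F                ≡⟨ central-factorials n ⟩
  (n + n) ! * suc n                    ≡⟨ *-suc ((n + n) !) n ⟩
  (n + n) ! + (n + n) ! * n            ∎)
  where
  open ≡-Reasoning
  F = n ! * suc n !

catalan≡ballot : ∀ n → catalan n ≡ ballot n 1
catalan≡ballot n = begin
  (2 * n) ! / F               ≡⟨ cong (λ j → j ! / F) (cong (n +_) (+-identityʳ n)) ⟩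
  (n + n) ! / F               ≡⟨ cong (_/ F) (ballot-one-factorials n) ⟨
  ballot n 1 * F / F          ≡⟨ m*n/n≡m (ballot n 1) F ⟩
  ballot n 1                  ∎
  where
  open ≡-Reasoning
  F = n ! * suc n !
  instance _ = n !* suc n !≢0

pow-catalan : ∀ r n → pow catalan r n ≡ ballot n r
pow-catalan zero    zero    = refl
pow-catalan zero    (suc n) = refl
pow-catalan (suc r) n = begin
  conv catalan (pow catalan r) n                  ≡⟨ sumTo-cong n (λ i → cong₂ _*_ (catalan≡ballot i) (pow-catalan r (n ∸ i))) ⟩
  conv (λ i → ballot i 1) (λ i → ballot i r) n    ≡⟨ ballot-convolution n 1 r ⟩
  ballot n (suc r)                                ∎
  where open ≡-Reasoning

-- Entries of permutations; deleting and inserting an entry.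

-- skip c : ℕ → ℕ ∖ {c} is the increasing bijection; ψ c (from Defs) is its
-- left inverse.  Inserting the value c into a permutation renumbers the other
-- values by skip c, deleting it renumbers them by ψ c.
skip : ℕ → ℕ → ℕ
skip c v = if v <ᵇ c then v else suc v

<ᵇ-true : ∀ {v c} → v < c → (v <ᵇ c) ≡ true
<ᵇ-true {zero}  {suc c} _         = refl
<ᵇ-true {suc v} {suc c} (s≤s v<c) = <ᵇ-true v<c

<ᵇ-false : ∀ {v c} → c ≤ v → (v <ᵇ c) ≡ false
<ᵇ-false {v}     {zero}  _         = refl
<ᵇ-false {suc v} {suc c} (s≤s c≤v) = <ᵇ-false c≤v

ψ-below : ∀ {c v} → v < c → ψ c v ≡ v
ψ-below v<c rewrite <ᵇ-true v<c = refl

ψ-above : ∀ {c v} → c ≤ v → ψ c v ≡ v ∸ 1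
ψ-above c≤v rewrite <ᵇ-false c≤v = refl

skip-below : ∀ {c v} → v < c → skip c v ≡ v
skip-below v<c rewrite <ᵇ-true v<c = refl

skip-above : ∀ {c v} → c ≤ v → skip c v ≡ suc v
skip-above c≤v rewrite <ᵇ-false c≤v = refl

skip-≢ : ∀ c v → skip c v ≢ c
skip-≢ c v with v <? c
... | yes v<c = λ e → <-irrefl (trans (sym (skip-below v<c)) e) v<c
... | no  v≮c = λ e → v≮c (≤-reflexive (trans (sym (skip-above (≮⇒≥ v≮c))) e))

skip-≤ : ∀ c v → skip c v ≤ suc v
skip-≤ c v with v <? c
... | yes v<c = ≤-trans (≤-reflexive (skip-below v<c)) (n≤1+n v)
... | no  v≮c = ≤-reflexive (skip-above (≮⇒≥ v≮c))

ψ-skip : ∀ c v → ψ c (skip c v) ≡ v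
ψ-skip c v with v <? c
... | yes v<c = trans (cong (ψ c) (skip-below v<c)) (ψ-below v<c)
... | no  v≮c = trans (cong (ψ c) (skip-above (≮⇒≥ v≮c))) (ψ-above (m≤n⇒m≤1+n (≮⇒≥ v≮c)))

skip-ψ : ∀ c v → v ≢ c → skip c (ψ c v) ≡ v
skip-ψ c v v≢c with v <? c
... | yes v<c = trans (cong (skip c) (ψ-below v<c)) (skip-below v<c)
... | no  v≮c = above v (≤∧≢⇒< (≮⇒≥ v≮c) (λ e → v≢c (sym e)))
  where
  above : ∀ v → c < v → skip c (ψ c v) ≡ v
  above (suc w) (s≤s c≤w) = trans (cong (skip c) (ψ-above (m≤n⇒m≤1+n c≤w))) (skip-above c≤w)

skip-injective : ∀ c {u v} → skip c u ≡ skip c v → u ≡ v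
skip-injective c {u} {v} e = trans (sym (ψ-skip c u)) (trans (cong (ψ c) e) (ψ-skip c v))

ψ-injective : ∀ c {u v} → u ≢ c → v ≢ c → ψ c u ≡ ψ c v → u ≡ v
ψ-injective c {u} {v} u≢c v≢c e = trans (sym (skip-ψ c u u≢c)) (trans (cong (skip c) e) (skip-ψ c v v≢c))

skip-cover : ∀ {k} c x → c < suc k → x < suc k → x ≡ c ⊎ Σ ℕ (λ y → y < k × x ≡ skip c y)
skip-cover {k} c x c<k x<k with <-cmp x c
... | tri≈ _ x≡c _ = inj₁ x≡c
... | tri< x<c _ _ = inj₂ (x , <-≤-trans x<c (≤-pred c<k) , sym (skip-below x<c))
skip-cover {k} c (suc y) _ (s≤s y<k) | tri> _ _ (s≤s c≤y) = inj₂ (y , y<k , sym (skip-above c≤y))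

skip-< : ∀ {k} c y → y < k → skip c y < suc k
skip-< c y y<k = ≤-<-trans (skip-≤ c y) (s≤s y<k)

-- Vectors read with natural-number indices, so that positions and values
-- live in the same arithmetic.
entry : ∀ {k} → Vec ℕ k → ℕ → ℕ
entry []       x       = 0
entry (v ∷ vs) zero    = v
entry (v ∷ vs) (suc x) = entry vs x

entry-lookup : ∀ {k} (τ : Vec ℕ k) (j : Fin k) → entry τ (toℕ j) ≡ lookup τ j
entry-lookup (v ∷ vs) F.zero    = refl
entry-lookup (v ∷ vs) (F.suc j) = entry-lookup vs j

entry-fromℕ< : ∀ {k} (τ : Vec ℕ k) {x} (x<k : x < k) → entry τ x ≡ lookup τ (fromℕ< x<k)
entry-fromℕ< τ x<k = trans (cong (entry τ) (sym (FinP.toℕ-fromℕ< x<k))) (entry-lookup τ (fromℕ< x<k))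

entry-ext : ∀ {k} (σ τ : Vec ℕ k) → (∀ x → x < k → entry σ x ≡ entry τ x) → σ ≡ τ
entry-ext []       []       _ = refl
entry-ext (u ∷ σ) (v ∷ τ) e = cong₂ _∷_ (e 0 z<s) (entry-ext σ τ (λ x x<k → e (suc x) (s≤s x<k)))

toℕ-punchIn : ∀ {k} (i : Fin (suc k)) (j : Fin k) → toℕ (punchIn i j) ≡ skip (toℕ i) (toℕ j)
toℕ-punchIn F.zero    j         = refl
toℕ-punchIn (F.suc i) F.zero    = refl
toℕ-punchIn (F.suc i) (F.suc j) with toℕ j <? toℕ i
... | yes j<i = trans (cong suc (trans (toℕ-punchIn i j) (skip-below j<i))) (sym (skip-below (s≤s j<i)))
... | no  j≮i = trans (cong suc (trans (toℕ-punchIn i j) (skip-above (≮⇒≥ j≮i)))) (sym (skip-above (s≤s (≮⇒≥ j≮i))))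

IsPermℕ : ∀ {k} → Vec ℕ k → Set
IsPermℕ {k} τ = (∀ x → x < k → entry τ x < k) × (∀ x y → x < k → y < k → entry τ x ≡ entry τ y → x ≡ y)

IsPerm⇒IsPermℕ : ∀ {k} {τ : Vec ℕ k} → IsPerm τ → IsPermℕ τ
IsPerm⇒IsPermℕ {k} {τ} (bounded , injective) =
  (λ x x<k → subst (_< k) (sym (entry-fromℕ< τ x<k)) (bounded (fromℕ< x<k))) ,
  (λ x y x<k y<k e → trans (sym (FinP.toℕ-fromℕ< x<k))
     (trans (cong toℕ (injective _ _ (trans (sym (entry-fromℕ< τ x<k)) (trans e (entry-fromℕ< τ y<k)))))
            (FinP.toℕ-fromℕ< y<k)))

IsPermℕ⇒IsPerm : ∀ {k} {τ : Vec ℕ k} → IsPermℕ τ → IsPerm τ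
IsPermℕ⇒IsPerm {k} {τ} (bounded , injective) =
  (λ j → subst (_< k) (entry-lookup τ j) (bounded (toℕ j) (FinP.toℕ<n j))) ,
  (λ j j' e → FinP.toℕ-injective (injective _ _ (FinP.toℕ<n j) (FinP.toℕ<n j')
     (trans (entry-lookup τ j) (trans e (sym (entry-lookup τ j'))))))

-- Deleting position i whose entry is c (both renumbered), and its inverse.
-- Both reduction types are instances of delete.
delete : ∀ {k} → Vec ℕ (suc k) → Fin (suc k) → ℕ → Vec ℕ k
delete τ i c = V.map (ψ c) (dropAt τ i)

insert : ∀ {k} → Vec ℕ k → Fin (suc k) → ℕ → Vec ℕ (suc k)
insert τ i c = insertAt (V.map (skip c) τ) i c

entry-delete : ∀ {k} (τ : Vec ℕ (suc k)) i c y → y < k → entry (delete τ i c) y ≡ ψ c (entry τ (skip (toℕ i) y))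
entry-delete τ i c y y<k = begin
  entry (delete τ i c) y                                    ≡⟨ entry-fromℕ< (delete τ i c) y<k ⟩
  lookup (V.map (ψ c) (dropAt τ i)) j                       ≡⟨ VecP.lookup-map j (ψ c) (dropAt τ i) ⟩
  ψ c (lookup (tabulate (λ j → lookup τ (punchIn i j))) j)  ≡⟨ cong (ψ c) (VecP.lookup∘tabulate _ j) ⟩
  ψ c (lookup τ (punchIn i j))                              ≡⟨ cong (ψ c) (entry-lookup τ (punchIn i j)) ⟨
  ψ c (entry τ (toℕ (punchIn i j)))                         ≡⟨ cong (λ x → ψ c (entry τ x)) (toℕ-punchIn i j) ⟩
  ψ c (entry τ (skip (toℕ i) (toℕ j)))                      ≡⟨ cong (λ x → ψ c (entry τ (skip (toℕ i) x))) (FinP.toℕ-fromℕ< y<k) ⟩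
  ψ c (entry τ (skip (toℕ i) y))                            ∎
  where
  open ≡-Reasoning
  j = fromℕ< y<k

entry-delete-before : ∀ {k} (τ : Vec ℕ (suc k)) i c x → x < toℕ i → entry (delete τ i c) x ≡ ψ c (entry τ x)
entry-delete-before τ i c x x<i =
  trans (entry-delete τ i c x (<-≤-trans x<i (≤-pred (FinP.toℕ<n i)))) (cong (λ z → ψ c (entry τ z)) (skip-below x<i))

entry-delete-after : ∀ {k} (τ : Vec ℕ (suc k)) i c y → toℕ i ≤ y → y < k → entry (delete τ i c) y ≡ ψ c (entry τ (suc y))
entry-delete-after τ i c y i≤y y<k = trans (entry-delete τ i c y y<k) (cong (λ z → ψ c (entry τ z)) (skip-above i≤y))

entry-insert-here : ∀ {k} (τ : Vec ℕ k) i c → entry (insert τ i c) (toℕ i) ≡ c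
entry-insert-here τ i c = trans (entry-lookup (insert τ i c) i) (VecP.insertAt-lookup (V.map (skip c) τ) i c)

entry-insert-skip : ∀ {k} (τ : Vec ℕ k) i c y → y < k → entry (insert τ i c) (skip (toℕ i) y) ≡ skip c (entry τ y)
entry-insert-skip τ i c y y<k = begin
  entry (insert τ i c) (skip (toℕ i) y)         ≡⟨ cong (λ x → entry (insert τ i c) (skip (toℕ i) x)) (FinP.toℕ-fromℕ< y<k) ⟨
  entry (insert τ i c) (skip (toℕ i) (toℕ j))   ≡⟨ cong (entry (insert τ i c)) (toℕ-punchIn i j) ⟨
  entry (insert τ i c) (toℕ (punchIn i j))      ≡⟨ entry-lookup (insert τ i c) (punchIn i j) ⟩
  lookup (insert τ i c) (punchIn i j)           ≡⟨ VecP.insertAt-punchIn (V.map (skip c) τ) i c j ⟩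
  lookup (V.map (skip c) τ) j                   ≡⟨ VecP.lookup-map j (skip c) τ ⟩
  skip c (lookup τ j)                           ≡⟨ cong (skip c) (entry-fromℕ< τ y<k) ⟨
  skip c (entry τ y)                            ∎
  where
  open ≡-Reasoning
  j = fromℕ< y<k

entry-insert-before : ∀ {k} (τ : Vec ℕ k) i c y → y < toℕ i → entry (insert τ i c) y ≡ skip c (entry τ y)
entry-insert-before τ i c y y<i = trans (cong (entry (insert τ i c)) (sym (skip-below y<i)))
  (entry-insert-skip τ i c y (<-≤-trans y<i (≤-pred (FinP.toℕ<n i))))

delete-perm : ∀ {k} (τ : Vec ℕ (suc k)) i c → IsPermℕ τ → entry τ (toℕ i) ≡ c → IsPermℕ (delete τ i c)
delete-perm {k} τ i c (bounded , injective) τi≡c = bounded′ , injective′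
  where
  x = toℕ i
  x<k : x < suc k
  x<k = FinP.toℕ<n i
  c<k : c < suc k
  c<k = subst (_< suc k) τi≡c (bounded x x<k)
  other : ∀ y → y < k → entry τ (skip x y) ≢ c
  other y y<k e = skip-≢ x y (injective _ _ (skip-< x y y<k) x<k (trans e (sym τi≡c)))
  ψ-< : ∀ v → v ≢ c → v < suc k → ψ c v < k
  ψ-< v v≢c v<k with v <? c
  ... | yes v<c = subst (_< k) (sym (ψ-below v<c)) (<-≤-trans v<c (≤-pred c<k))
  ... | no  v≮c = above v (≤∧≢⇒< (≮⇒≥ v≮c) (λ e → v≢c (sym e))) v<k
    where
    above : ∀ v → c < v → v < suc k → ψ c v < k
    above (suc w) (s≤s c≤w) (s≤s w<k) = subst (_< k) (sym (ψ-above (m≤n⇒m≤1+n c≤w))) w<k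
  bounded′ : ∀ y → y < k → entry (delete τ i c) y < k
  bounded′ y y<k = subst (_< k) (sym (entry-delete τ i c y y<k))
    (ψ-< _ (other y y<k) (bounded _ (skip-< x y y<k)))
  injective′ : ∀ y z → y < k → z < k → entry (delete τ i c) y ≡ entry (delete τ i c) z → y ≡ z
  injective′ y z y<k z<k e = skip-injective x (injective _ _ (skip-< x y y<k) (skip-< x z z<k)
    (ψ-injective c (other y y<k) (other z z<k)
      (trans (sym (entry-delete τ i c y y<k)) (trans e (entry-delete τ i c z z<k)))))

insert-perm : ∀ {k} (τ : Vec ℕ k) i c → IsPermℕ τ → c ≤ k → IsPermℕ (insert τ i c)
insert-perm {k} τ i c (bounded , injective) c≤k = bounded′ , injective′
  where
  x = toℕ i
  x<k : x < suc k
  x<k = FinP.toℕ<n i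
  here≢skip : ∀ y → y < k → entry (insert τ i c) x ≢ entry (insert τ i c) (skip x y)
  here≢skip y y<k e = skip-≢ c (entry τ y) (sym (trans (sym (entry-insert-here τ i c)) (trans e (entry-insert-skip τ i c y y<k))))
  bounded′ : ∀ z → z < suc k → entry (insert τ i c) z < suc k
  bounded′ z z<k with skip-cover x z x<k z<k
  ... | inj₁ refl = subst (_< suc k) (sym (entry-insert-here τ i c)) (s≤s c≤k)
  ... | inj₂ (y , y<k , refl) = subst (_< suc k) (sym (entry-insert-skip τ i c y y<k)) (skip-< c _ (bounded y y<k))
  injective′ : ∀ z w → z < suc k → w < suc k → entry (insert τ i c) z ≡ entry (insert τ i c) w → z ≡ w
  injective′ z w z<k w<k e with skip-cover x z x<k z<k | skip-cover x w x<k w<k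
  ... | inj₁ refl              | inj₁ refl                = refl
  ... | inj₁ refl              | inj₂ (y , y<k , refl)    = ⊥-elim (here≢skip y y<k e)
  ... | inj₂ (y , y<k , refl)  | inj₁ refl                = ⊥-elim (here≢skip y y<k (sym e))
  ... | inj₂ (y , y<k , refl)  | inj₂ (y′ , y′<k , refl) = cong (skip x) (injective y y′ y<k y′<k
    (skip-injective c (trans (sym (entry-insert-skip τ i c y y<k)) (trans e (entry-insert-skip τ i c y′ y′<k)))))

delete-insert : ∀ {k} (τ : Vec ℕ k) i c → delete (insert τ i c) i c ≡ τ
delete-insert τ i c = entry-ext _ _ λ y y<k →
  trans (entry-delete (insert τ i c) i c y y<k) (trans (cong (ψ c) (entry-insert-skip τ i c y y<k)) (ψ-skip c (entry τ y)))

insert-delete : ∀ {k} (τ : Vec ℕ (suc k)) i c → IsPermℕ τ → entry τ (toℕ i) ≡ c → insert (delete τ i c) i c ≡ τ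
insert-delete {k} τ i c (_ , injective) τi≡c = entry-ext _ _ agree
  where
  x = toℕ i
  x<k : x < suc k
  x<k = FinP.toℕ<n i
  agree : ∀ z → z < suc k → entry (insert (delete τ i c) i c) z ≡ entry τ z
  agree z z<k with skip-cover x z x<k z<k
  ... | inj₁ refl = trans (entry-insert-here _ i c) (sym τi≡c)
  ... | inj₂ (y , y<k , refl) = begin
    entry (insert (delete τ i c) i c) (skip x y)  ≡⟨ entry-insert-skip _ i c y y<k ⟩
    skip c (entry (delete τ i c) y)               ≡⟨ cong (skip c) (entry-delete τ i c y y<k) ⟩
    skip c (ψ c (entry τ (skip x y)))             ≡⟨ skip-ψ c _ (λ e → skip-≢ x y (injective _ _ (skip-< x y y<k) x<k (trans e (sym τi≡c)))) ⟩
    entry τ (skip x y)                            ∎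
    where open ≡-Reasoning

-- Arcs, reduction steps and confluence.

-- An arc of τ is a position x with τ(x) ∈ {x, x+1}: exactly the positions at
-- which a reduction (of type 1 or 2) can be applied.
IsArc : ℕ → ℕ → Set
IsArc x c = c ≡ x ⊎ c ≡ suc x

arc-≤ : ∀ {x c} → IsArc x c → c ≤ suc x
arc-≤ (inj₁ refl) = n≤1+n _
arc-≤ (inj₂ refl) = ≤-refl

arc-≥ : ∀ {x c} → IsArc x c → x ≤ c
arc-≥ (inj₁ refl) = ≤-refl
arc-≥ (inj₂ refl) = n≤1+n _

φ≗ψ-suc : ∀ i v → φ i v ≡ ψ (suc i) v
φ≗ψ-suc i zero    = refl
φ≗ψ-suc i (suc v) = refl

step⇒arc-deletion : ∀ {k} {τ : Vec ℕ (suc k)} {τ′ : Vec ℕ k} → Step τ τ′ →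
  Σ (Fin (suc k)) λ i → Σ ℕ λ c → entry τ (toℕ i) ≡ c × IsArc (toℕ i) c × τ′ ≡ delete τ i c
step⇒arc-deletion (type1 τ i τi≡i)   = i , toℕ i , trans (entry-lookup τ i) τi≡i , inj₁ refl , refl
step⇒arc-deletion (type2 τ i τi≡i+1) =
  i , suc (toℕ i) , trans (entry-lookup τ i) τi≡i+1 , inj₂ refl , VecP.map-cong (φ≗ψ-suc (toℕ i)) (dropAt τ i)

arc-deletion⇒step : ∀ {k} (τ : Vec ℕ (suc k)) i c → IsPermℕ τ → entry τ (toℕ i) ≡ c → IsArc (toℕ i) c → Step τ (delete τ i c)
arc-deletion⇒step τ i c _ τi≡c (inj₁ refl) = type1 τ i (trans (sym (entry-lookup τ i)) τi≡c)
arc-deletion⇒step {zero} τ F.zero c (bounded , _) τ0≡c (inj₂ refl) =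
  ⊥-elim (<-irrefl refl (subst (_< 1) τ0≡c (bounded 0 z<s)))
arc-deletion⇒step {suc k} τ i c _ τi≡c (inj₂ refl) =
  subst (Step τ) (VecP.map-cong (φ≗ψ-suc (toℕ i)) (dropAt τ i)) (type2 τ i (trans (sym (entry-lookup τ i)) τi≡c))

Straight : ∀ {m} → Vec ℕ m → Set
Straight {m} π = IsPermℕ π × (∀ x → x < m → ¬ IsArc x (entry π x))

IsStraightMenage⇒Straight : ∀ {m} {π : Vec ℕ m} → IsStraightMenage π → Straight π
IsStraightMenage⇒Straight {m} {π} (perm , no-arc) = IsPerm⇒IsPermℕ {τ = π} perm , λ x x<m →
  let j = fromℕ< x<m
      πx≡πj = entry-fromℕ< π x<m
      j≡x = FinP.toℕ-fromℕ< x<m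
  in [ (λ πx≡x   → proj₁ (no-arc j) (trans (sym πx≡πj) (trans πx≡x (sym j≡x))))
     , (λ πx≡x+1 → proj₂ (no-arc j) (trans (sym πx≡πj) (trans πx≡x+1 (cong suc (sym j≡x))))) ]

reduces-size : ∀ {a b} {τ : Vec ℕ a} {π : Vec ℕ b} → ReducesTo τ π → b ≤ a
reduces-size done       = ≤-refl
reduces-size (step _ r) = m≤n⇒m≤1+n (reduces-size r)

reduces-same-size : ∀ {a} {τ π : Vec ℕ a} → ReducesTo τ π → τ ≡ π
reduces-same-size done       = refl
reduces-same-size (step _ r) = ⊥-elim (<-irrefl refl (reduces-size r))

reduces-has-arc : ∀ {k b} {τ : Vec ℕ (suc k)} {π : Vec ℕ b} → ReducesTo τ π → b ≤ k →
  Σ (Fin (suc k)) λ i → IsArc (toℕ i) (entry τ (toℕ i))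
reduces-has-arc done b≤k = ⊥-elim (<-irrefl refl b≤k)
reduces-has-arc (step s _) _ with step⇒arc-deletion s
... | i , c , τi≡c , arc , _ = i , subst (IsArc (toℕ i)) (sym τi≡c) arc

-- Deleting positions xa < xb (stated as skipping xb = yb+1 after xa, or xa after yb).
skip-skip : ∀ xa yb y → xa ≤ yb → skip (suc yb) (skip xa y) ≡ skip xa (skip yb y)
skip-skip xa yb y xa≤yb with y <? xa
... | yes y<xa = trans (cong (skip (suc yb)) (skip-below y<xa))
    (trans (skip-below (<-≤-trans y<xa (m≤n⇒m≤1+n xa≤yb)))
    (sym (trans (cong (skip xa) (skip-below (<-≤-trans y<xa xa≤yb))) (skip-below y<xa))))
... | no y≮xa with y <? yb
...   | yes y<yb = trans (cong (skip (suc yb)) (skip-above (≮⇒≥ y≮xa))) (trans (skip-below (s≤s y<yb))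
    (sym (trans (cong (skip xa) (skip-below y<yb)) (skip-above (≮⇒≥ y≮xa)))))
...   | no y≮yb = trans (cong (skip (suc yb)) (skip-above (≮⇒≥ y≮xa))) (trans (skip-above (s≤s (≮⇒≥ y≮yb)))
    (sym (trans (cong (skip xa) (skip-above (≮⇒≥ y≮yb))) (skip-above (m≤n⇒m≤1+n (≮⇒≥ y≮xa))))))

ψ-ψ : ∀ ca cb v → ca < cb → v ≢ ca → v ≢ cb → ψ ca (ψ cb v) ≡ ψ (cb ∸ 1) (ψ ca v)
ψ-ψ ca (suc cb) v ca<cb v≢ca v≢cb with v <? ca
... | yes v<ca = trans (cong (ψ ca) (ψ-below (<-trans v<ca ca<cb))) (trans (ψ-below v<ca)
    (sym (trans (cong (ψ cb) (ψ-below v<ca)) (ψ-below (<-≤-trans v<ca (≤-pred ca<cb))))))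
... | no v≮ca = above v (≤∧≢⇒< (≮⇒≥ v≮ca) (λ e → v≢ca (sym e))) v≢cb
  where
  beyond : ∀ w → cb < w → ca ≤ w → ψ ca (ψ (suc cb) (suc w)) ≡ ψ cb (ψ ca (suc w))
  beyond (suc u) (s≤s cb≤u) ca≤w = trans (cong (ψ ca) (ψ-above (s≤s (m≤n⇒m≤1+n cb≤u)))) (trans (ψ-above ca≤w)
    (sym (trans (cong (ψ cb) (ψ-above (m≤n⇒m≤1+n ca≤w))) (ψ-above (m≤n⇒m≤1+n cb≤u)))))
  above : ∀ v → ca < v → v ≢ suc cb → ψ ca (ψ (suc cb) v) ≡ ψ cb (ψ ca v)
  above (suc w) (s≤s ca≤w) v≢cb with w <? cb
  ... | yes w<cb = trans (cong (ψ ca) (ψ-below (s≤s w<cb))) (trans (ψ-above (m≤n⇒m≤1+n ca≤w))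
      (sym (trans (cong (ψ cb) (ψ-above (m≤n⇒m≤1+n ca≤w))) (ψ-below w<cb))))
  ... | no w≮cb = beyond w (≤∧≢⇒< (≮⇒≥ w≮cb) (λ e → v≢cb (cong suc (sym e)))) ca≤w

delete-twice : ∀ {k} (τ : Vec ℕ (suc (suc k))) (a b : Fin (suc (suc k))) (a′ b′ : Fin (suc k)) ca cb →
  IsPermℕ τ → entry τ (toℕ a) ≡ ca → entry τ (toℕ b) ≡ cb → ca < cb →
  toℕ a′ ≡ toℕ a → toℕ b ≡ suc (toℕ b′) → toℕ a ≤ toℕ b′ →
  delete (delete τ b cb) a′ ca ≡ delete (delete τ a ca) b′ (cb ∸ 1)
delete-twice τ a b a′ b′ ca cb (_ , injective) τa≡ca τb≡cb ca<cb a′≡a b≡b′+1 a≤b′ =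
  entry-ext _ _ λ y y<k →
  let P = skip xb (skip xa y)
      P≡ : P ≡ skip xa (skip yb y)
      P≡ = trans (cong (λ z → skip z (skip xa y)) b≡b′+1) (skip-skip xa yb y a≤b′)
      P< = skip-< xb (skip xa y) (skip-< xa y y<k)
      τP≢ca : entry τ P ≢ ca
      τP≢ca e = skip-≢ xa (skip yb y) (trans (sym P≡) (injective P xa P< (FinP.toℕ<n a) (trans e (sym τa≡ca))))
      τP≢cb : entry τ P ≢ cb
      τP≢cb e = skip-≢ xb (skip xa y) (injective P xb P< (FinP.toℕ<n b) (trans e (sym τb≡cb)))
      open ≡-Reasoning
  in begin
    entry (delete (delete τ b cb) a′ ca) y      ≡⟨ entry-delete (delete τ b cb) a′ ca y y<k ⟩
    ψ ca (entry (delete τ b cb) (skip (toℕ a′) y))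
      ≡⟨ cong (λ z → ψ ca (entry (delete τ b cb) (skip z y))) a′≡a ⟩
    ψ ca (entry (delete τ b cb) (skip xa y))    ≡⟨ cong (ψ ca) (entry-delete τ b cb (skip xa y) (skip-< xa y y<k)) ⟩
    ψ ca (ψ cb (entry τ P))                     ≡⟨ ψ-ψ ca cb (entry τ P) ca<cb τP≢ca τP≢cb ⟩
    ψ (cb ∸ 1) (ψ ca (entry τ P))               ≡⟨ cong (λ z → ψ (cb ∸ 1) (ψ ca (entry τ z))) P≡ ⟩
    ψ (cb ∸ 1) (ψ ca (entry τ (skip xa (skip yb y))))
      ≡⟨ cong (ψ (cb ∸ 1)) (entry-delete τ a ca (skip yb y) (skip-< yb y y<k)) ⟨
    ψ (cb ∸ 1) (entry (delete τ a ca) (skip yb y)) ≡⟨ entry-delete (delete τ a ca) b′ (cb ∸ 1) y y<k ⟨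
    entry (delete (delete τ a ca) b′ (cb ∸ 1)) y ∎
  where
  xa = toℕ a
  xb = toℕ b
  yb = toℕ b′

-- The local confluence square for two distinct arcs i, j of τ: after deleting
-- one of them the other is still an arc (at position i′ resp. j′, with value
-- ci′ resp. cj′), and deleting the second one leads to the same permutation.
record Diamond {k} (τ : Vec ℕ (suc (suc k))) (i : Fin (suc (suc k))) (ci : ℕ) (j : Fin (suc (suc k))) (cj : ℕ) : Set where
  field
    i′ j′     : Fin (suc k)
    ci′ cj′   : ℕ
    i′-arc    : entry (delete τ j cj) (toℕ i′) ≡ ci′ × IsArc (toℕ i′) ci′
    j′-arc    : entry (delete τ i ci) (toℕ j′) ≡ cj′ × IsArc (toℕ j′) cj′
    commute   : delete (delete τ j cj) i′ ci′ ≡ delete (delete τ i ci) j′ cj′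

swap-diamond : ∀ {k} {τ : Vec ℕ (suc (suc k))} {i ci j cj} → Diamond τ i ci j cj → Diamond τ j cj i ci
swap-diamond d = record { i′ = j′ ; j′ = i′ ; ci′ = cj′ ; cj′ = ci′ ; i′-arc = j′-arc ; j′-arc = i′-arc ; commute = sym commute }
  where open Diamond d

arcs-increasing : ∀ {k} (τ : Vec ℕ k) {xa xb ca cb} → IsPermℕ τ → xb < k →
  entry τ xa ≡ ca → IsArc xa ca → entry τ xb ≡ cb → IsArc xb cb → xa < xb → ca < cb
arcs-increasing τ (_ , injective) xb<k τa≡ca arc-a τb≡cb arc-b a<b =
  ≤∧≢⇒< (≤-trans (arc-≤ arc-a) (≤-trans a<b (arc-≥ arc-b)))
        (λ ca≡cb → <-irrefl (injective _ _ (<-trans a<b xb<k) xb<k (trans τa≡ca (trans ca≡cb (sym τb≡cb)))) a<b)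

-- Arcs a < b: position a keeps its index and value when b is deleted, while
-- b moves to b−1 with value cb−1 when a is deleted.
ordered-diamond : ∀ {k} (τ : Vec ℕ (suc (suc k))) (a b : Fin (suc (suc k))) ca cb → IsPermℕ τ →
  entry τ (toℕ a) ≡ ca → IsArc (toℕ a) ca → entry τ (toℕ b) ≡ cb → IsArc (toℕ b) cb → toℕ a < toℕ b →
  Diamond τ a ca b cb
ordered-diamond {k} τ a b ca cb perm τa≡ca arc-a τb≡cb arc-b a<b = record
  { i′ = a′ ; j′ = b′ ; ci′ = ca ; cj′ = cb ∸ 1
  ; i′-arc = a′-entry , subst (λ x → IsArc x ca) (sym a′≡a) arc-a
  ; j′-arc = b′-entry , subst (λ x → IsArc x (cb ∸ 1)) (sym b′≡yb) (shift arc-b)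
  ; commute = delete-twice τ a b a′ b′ ca cb perm τa≡ca τb≡cb ca<cb a′≡a b≡b′+1 a≤b′
  }
  where
  xa = toℕ a
  xb = toℕ b
  yb = pred xb
  b≡yb+1 : xb ≡ suc yb
  b≡yb+1 = sym (suc-pred xb {{>-nonZero (≤-<-trans z≤n a<b)}})
  a<k : xa < suc k
  a<k = ≤-trans a<b (≤-pred (FinP.toℕ<n b))
  yb<k : yb < suc k
  yb<k = ≤-pred (subst (_< suc (suc k)) b≡yb+1 (FinP.toℕ<n b))
  a′ = fromℕ< a<k
  b′ = fromℕ< yb<k
  a′≡a : toℕ a′ ≡ xa
  a′≡a = FinP.toℕ-fromℕ< a<k
  b′≡yb : toℕ b′ ≡ yb
  b′≡yb = FinP.toℕ-fromℕ< yb<k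
  b≡b′+1 : xb ≡ suc (toℕ b′)
  b≡b′+1 = trans b≡yb+1 (cong suc (sym b′≡yb))
  a≤b′ : xa ≤ toℕ b′
  a≤b′ = ≤-pred (subst (xa <_) b≡b′+1 a<b)
  ca<cb : ca < cb
  ca<cb = arcs-increasing τ perm (FinP.toℕ<n b) τa≡ca arc-a τb≡cb arc-b a<b
  a′-entry : entry (delete τ b cb) (toℕ a′) ≡ ca
  a′-entry = begin
    entry (delete τ b cb) (toℕ a′)  ≡⟨ cong (entry (delete τ b cb)) a′≡a ⟩
    entry (delete τ b cb) xa        ≡⟨ entry-delete-before τ b cb xa a<b ⟩
    ψ cb (entry τ xa)               ≡⟨ cong (ψ cb) τa≡ca ⟩
    ψ cb ca                         ≡⟨ ψ-below ca<cb ⟩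
    ca                              ∎
    where open ≡-Reasoning
  b′-entry : entry (delete τ a ca) (toℕ b′) ≡ cb ∸ 1
  b′-entry = begin
    entry (delete τ a ca) (toℕ b′)  ≡⟨ entry-delete-after τ a ca (toℕ b′) a≤b′ (FinP.toℕ<n b′) ⟩
    ψ ca (entry τ (suc (toℕ b′)))   ≡⟨ cong (λ x → ψ ca (entry τ x)) b≡b′+1 ⟨
    ψ ca (entry τ xb)               ≡⟨ cong (ψ ca) τb≡cb ⟩
    ψ ca cb                         ≡⟨ ψ-above (<⇒≤ ca<cb) ⟩
    cb ∸ 1                          ∎
    where open ≡-Reasoning
  shift : IsArc xb cb → IsArc yb (cb ∸ 1)
  shift (inj₁ cb≡b)   = inj₁ (cong (_∸ 1) (trans cb≡b b≡yb+1))
  shift (inj₂ cb≡b+1) = inj₂ (trans (cong (_∸ 1) cb≡b+1) b≡yb+1)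

diamond : ∀ {k} (τ : Vec ℕ (suc (suc k))) (i j : Fin (suc (suc k))) ci cj → IsPermℕ τ →
  entry τ (toℕ i) ≡ ci → IsArc (toℕ i) ci → entry τ (toℕ j) ≡ cj → IsArc (toℕ j) cj → i ≢ j →
  Diamond τ i ci j cj
diamond τ i j ci cj perm τi≡ci arc-i τj≡cj arc-j i≢j with <-cmp (toℕ i) (toℕ j)
... | tri< i<j _ _ = ordered-diamond τ i j ci cj perm τi≡ci arc-i τj≡cj arc-j i<j
... | tri≈ _ i≡j _ = ⊥-elim (i≢j (FinP.toℕ-injective i≡j))
... | tri> _ _ j<i = swap-diamond (ordered-diamond τ j i cj ci perm τj≡cj arc-j τi≡ci arc-i j<i)

distinct-positions : ∀ {k} (i j : Fin (suc k)) → i ≢ j → Σ ℕ λ k′ → k ≡ suc k′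
distinct-positions {zero}  F.zero F.zero i≢j = ⊥-elim (i≢j refl)
distinct-positions {suc k} _      _      _   = k , refl

arc-deletion-reduces : ∀ {k b} {τ : Vec ℕ (suc k)} {π : Vec ℕ b} → Straight π → ReducesTo τ π → IsPermℕ τ →
  ∀ i c → entry τ (toℕ i) ≡ c → IsArc (toℕ i) c → ReducesTo (delete τ i c) π
arc-deletion-reduces (_ , no-arc) done _ i c τi≡c arc =
  ⊥-elim (no-arc (toℕ i) (FinP.toℕ<n i) (subst (IsArc (toℕ i)) (sym τi≡c) arc))
arc-deletion-reduces {τ = τ} {π} straight (step s r) perm i c τi≡c arc
  with step⇒arc-deletion s
... | j , cj , τj≡cj , arc-j , refl with i F.≟ j
...   | yes refl with trans (sym τi≡c) τj≡cj
...     | refl = r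
arc-deletion-reduces {τ = τ} {π} straight (step s r) perm i c τi≡c arc
    | j , cj , τj≡cj , arc-j , refl | no i≢j with distinct-positions i j i≢j
...     | _ , refl =
  step (arc-deletion⇒step (delete τ i c) j′ cj′ (delete-perm τ i c perm τi≡c) (proj₁ j′-arc) (proj₂ j′-arc))
       (subst (λ σ → ReducesTo σ π) commute
         (arc-deletion-reduces straight r (delete-perm τ j cj perm τj≡cj) i′ ci′ (proj₁ i′-arc) (proj₂ i′-arc)))
  where open Diamond (diamond τ i j c cj perm τi≡c arc τj≡cj arc-j i≢j)

-- The first arc and the slot count.

arc? : ∀ x c → Dec (IsArc x c)
arc? x c = (c ≟ x) ⊎-dec (c ≟ suc x)

scan : (ℕ → ℕ) → ℕ → ℕ → ℕ → ℕ
scan f o zero    d = d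
scan f o (suc n) d with arc? o (f o)
... | yes _ = o + f o + 2
... | no  _ = scan f (suc o) n d

NoArcBetween : (ℕ → ℕ) → ℕ → ℕ → Set
NoArcBetween f o x = ∀ y → o ≤ y → y < x → ¬ IsArc y (f y)

no-arc-extend : ∀ f o {x} → ¬ IsArc o (f o) → NoArcBetween f (suc o) x → NoArcBetween f o x
no-arc-extend f o ¬arc none y o≤y y<x with y ≟ o
... | yes refl = ¬arc
... | no  y≢o  = none y (≤∧≢⇒< o≤y (λ e → y≢o (sym e))) y<x

scan-view : ∀ f o n d →
  (scan f o n d ≡ d × NoArcBetween f o (o + n)) ⊎
  Σ ℕ λ x → o ≤ x × x < o + n × IsArc x (f x) × NoArcBetween f o x × scan f o n d ≡ x + f x + 2
scan-view f o zero    d = inj₁ (refl , λ y o≤y y<o+0 _ → <-irrefl refl (<-≤-trans y<o+0 (subst (_≤ y) (sym (+-identityʳ o)) o≤y)))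
scan-view f o (suc n) d with arc? o (f o)
... | yes arc = inj₂ (o , ≤-refl , m<m+n o z<s , arc , (λ y o≤y y<o _ → <-irrefl refl (<-≤-trans y<o o≤y)) , refl)
... | no ¬arc with scan-view f (suc o) n d
...   | inj₁ (≡d , none) =
  inj₁ (≡d , λ y o≤y y<end → no-arc-extend f o ¬arc none y o≤y (subst (y <_) (+-suc o n) y<end))
...   | inj₂ (x , o<x , x<end , arc , none , ≡x) =
  inj₂ (x , ≤-trans (n≤1+n o) o<x , subst (x <_) (sym (+-suc o n)) x<end , arc , no-arc-extend f o ¬arc none , ≡x)

scan-lower-bound : ∀ f o n d B → B ≤ d → (∀ x → o ≤ x → x < o + n → IsArc x (f x) → B ≤ x + f x + 2) → B ≤ scan f o n d
scan-lower-bound f o n d B B≤d B≤arcs with scan-view f o n d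
... | inj₁ (≡d , _)                  = subst (B ≤_) (sym ≡d) B≤d
... | inj₂ (x , o≤x , x<end , arc , _ , ≡x) = subst (B ≤_) (sym ≡x) (B≤arcs x o≤x x<end arc)

scan-first-arc : ∀ f o n d x → o ≤ x → x < o + n → IsArc x (f x) → NoArcBetween f o x → scan f o n d ≡ x + f x + 2
scan-first-arc f o n d x o≤x x<end arc none with scan-view f o n d
... | inj₁ (_ , none′) = ⊥-elim (none′ x o≤x x<end arc)
... | inj₂ (x₀ , o≤x₀ , _ , arc₀ , none₀ , ≡x₀) with <-cmp x₀ x
...   | tri< x₀<x _ _    = ⊥-elim (none x₀ o≤x₀ x₀<x arc₀)
...   | tri≈ _ refl _    = ≡x₀
...   | tri> _ _ x<x₀    = ⊥-elim (none₀ x o≤x x<x₀ arc)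

-- Any arc bounds the scan result from above, since arcs further right have
-- larger x + f x.
scan-upper-bound : ∀ f o n d x → o ≤ x → x < o + n → IsArc x (f x) → scan f o n d ≤ x + f x + 2
scan-upper-bound f o n d x o≤x x<end arc with scan-view f o n d
... | inj₁ (_ , none) = ⊥-elim (none x o≤x x<end arc)
... | inj₂ (x₀ , o≤x₀ , _ , arc₀ , none₀ , ≡x₀) with <-cmp x₀ x
...   | tri< x₀<x _ _ = subst (_≤ x + f x + 2) (sym ≡x₀)
  (+-monoˡ-≤ 2 (+-mono-≤ (<⇒≤ x₀<x) (≤-trans (arc-≤ arc₀) (≤-trans x₀<x (arc-≥ arc)))))
...   | tri≈ _ refl _ = ≤-reflexive ≡x₀
...   | tri> _ _ x<x₀ = ⊥-elim (none₀ x o≤x x<x₀ arc)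

-- The number of children of τ in the generating tree: x + τ(x) + 2 for the
-- first arc x of τ, and 2k + 1 if τ has no arc.  Its children are obtained by
-- inserting a new arc before the first one, in any of these many ways.
slots : ∀ {k} → Vec ℕ k → ℕ
slots {k} τ = scan (entry τ) 0 k (suc (k + k))

slots-≤ : ∀ {k} (τ : Vec ℕ k) → IsPermℕ τ → slots τ ≤ suc (k + k)
slots-≤ {k} τ (bounded , _) with scan-view (entry τ) 0 k (suc (k + k))
... | inj₁ (≡d , _) = ≤-reflexive ≡d
... | inj₂ (x , _ , x<k , _ , _ , ≡x) =
  subst (_≤ suc (k + k)) (sym (trans ≡x (+-comm _ 2)))
    (m≤n⇒m≤1+n (subst (_≤ k + k) (cong suc (+-suc x (entry τ x))) (+-mono-≤ x<k (bounded x x<k))))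

slot-≤ : ∀ {k} (τ : Vec ℕ k) {g} → IsPermℕ τ → g < slots τ → g ≤ k + k
slot-≤ τ perm g<slots = ≤-pred (<-≤-trans g<slots (slots-≤ τ perm))

slots-straight : ∀ {m} (π : Vec ℕ m) → Straight π → slots π ≡ suc (m + m)
slots-straight {m} π (_ , no-arc) with scan-view (entry π) 0 m (suc (m + m))
... | inj₁ (≡d , _) = ≡d
... | inj₂ (x , _ , x<m , arc , _ , _) = ⊥-elim (no-arc x x<m arc)

-- The arcs (x, c) with c ≤ k are encoded bijectively by g = x + c ∈ [0, 2k]:
-- g = 2x gives (x, x) and g = 2x + 1 gives (x, x + 1).
decodeArc : (k : ℕ) → ℕ → Fin (suc k) × ℕ
decodeArc k       zero          = F.zero , 0
decodeArc k       (suc zero)    = F.zero , 1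
decodeArc zero    (suc (suc g)) = F.zero , 0
decodeArc (suc k) (suc (suc g)) = F.suc (proj₁ (decodeArc k g)) , suc (proj₂ (decodeArc k g))

decodeArc-sound : ∀ k g → g ≤ k + k →
  let (i , c) = decodeArc k g in toℕ i + c ≡ g × IsArc (toℕ i) c × c ≤ k
decodeArc-sound k       zero          _ = refl , inj₁ refl , z≤n
decodeArc-sound zero    (suc zero)    ()
decodeArc-sound (suc k) (suc zero)    _ = refl , inj₂ refl , s≤s z≤n
decodeArc-sound zero    (suc (suc g)) ()
decodeArc-sound (suc k) (suc (suc g)) (s≤s g+1≤) with decodeArc-sound k g (≤-pred (subst (suc g ≤_) (+-suc k k) g+1≤))
... | x+c≡g , arc , c≤k = cong suc (trans (+-suc _ _) (cong suc x+c≡g)) , Sum.map (cong suc) (cong suc) arc , s≤s c≤k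

decodeArc-complete : ∀ k x c → IsArc x c → c ≤ k →
  toℕ (proj₁ (decodeArc k (x + c))) ≡ x × proj₂ (decodeArc k (x + c)) ≡ c
decodeArc-complete k       zero    .0 (inj₁ refl) _ = refl , refl
decodeArc-complete k       zero    .1 (inj₂ refl) _ = refl , refl
decodeArc-complete k       (suc x) zero (inj₁ ()) _
decodeArc-complete k       (suc x) zero (inj₂ ()) _
decodeArc-complete zero    (suc x) (suc c) _ ()
decodeArc-complete (suc k) (suc x) (suc c) arc (s≤s c≤k) rewrite +-suc x c
  with decodeArc-complete k x c (Sum.map suc-injective suc-injective arc) c≤k
... | ≡x , ≡c = cong suc ≡x , cong suc ≡c

insertSlot : ∀ {k} → Vec ℕ k → ℕ → Vec ℕ (suc k)
insertSlot {k} τ g = insert τ (proj₁ (decodeArc k g)) (proj₂ (decodeArc k g))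

arc-left-of-insert : ∀ {k} (τ : Vec ℕ k) i c y → toℕ i ≤ c → y < toℕ i →
  IsArc y (entry (insert τ i c) y) → entry τ y < c × IsArc y (entry τ y)
arc-left-of-insert τ i c y i≤c y<i arc⁺ with entry τ y <? c
... | yes τy<c = τy<c , subst (IsArc y) (trans (entry-insert-before τ i c y y<i) (skip-below τy<c)) arc⁺
... | no  τy≮c = ⊥-elim (<-irrefl refl (≤-<-trans (≤-trans (≮⇒≥ τy≮c) τy≤y) (<-≤-trans y<i i≤c)))
  where
  τy≤y : entry τ y ≤ y
  τy≤y = ≤-pred (arc-≤ (subst (IsArc y) (trans (entry-insert-before τ i c y y<i) (skip-above (≮⇒≥ τy≮c))) arc⁺))

-- The g-th child of τ has exactly g + 2 children: the inserted arc becomes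
-- its first arc, because g is smaller than the code x + τ(x) + 2 of the first arc of τ.
slots-insertSlot : ∀ {k} (τ : Vec ℕ k) g → g < slots τ → g ≤ k + k → slots (insertSlot τ g) ≡ g + 2
slots-insertSlot {k} τ g g<slots g≤2k =
  trans (scan-first-arc (entry τ⁺) 0 (suc k) _ x z≤n (FinP.toℕ<n i) arc⁺ none)
        (cong (_+ 2) (trans (cong (x +_) (entry-insert-here τ i c)) x+c≡g))
  where
  i = proj₁ (decodeArc k g)
  c = proj₂ (decodeArc k g)
  x = toℕ i
  τ⁺ = insert τ i c
  x+c≡g : x + c ≡ g
  x+c≡g = proj₁ (decodeArc-sound k g g≤2k)
  arc : IsArc x c
  arc = proj₁ (proj₂ (decodeArc-sound k g g≤2k))
  arc⁺ : IsArc x (entry τ⁺ x)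
  arc⁺ = subst (IsArc x) (sym (entry-insert-here τ i c)) arc
  none : NoArcBetween (entry τ⁺) 0 x
  none y _ y<x arc-y with arc-left-of-insert τ i c y (arc-≥ arc) y<x arc-y
  ... | τy<c , arc-τy = <-irrefl refl (<-≤-trans g<slots (≤-trans
    (scan-upper-bound (entry τ) 0 k _ y z≤n (<-≤-trans y<x (≤-pred (FinP.toℕ<n i))) arc-τy)
    (subst₂ _≤_ (sym (code y (entry τ y))) x+c≡g (+-mono-≤ y<x τy<c))))
    where
    code : ∀ y v → y + v + 2 ≡ suc y + suc v
    code y v = trans (+-comm (y + v) 2) (cong suc (sym (+-suc y v)))

arc-after-first-deletion : ∀ {k} (τ : Vec ℕ (suc k)) i c → IsPermℕ τ → entry τ (toℕ i) ≡ c → IsArc (toℕ i) c →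
  NoArcBetween (entry τ) 0 (toℕ i) → ∀ y → IsArc y (entry (delete τ i c) y) →
  toℕ i + c ≤ suc (y + entry (delete τ i c) y)
arc-after-first-deletion τ i c (_ , injective) τi≡c arc first y arc-y with y <? toℕ i
... | no y≮x = subst (toℕ i + c ≤_) (+-suc y _)
  (+-mono-≤ (≮⇒≥ y≮x) (≤-trans (arc-≤ arc) (s≤s (≤-trans (≮⇒≥ y≮x) (arc-≥ arc-y)))))
... | yes y<x with entry τ y <? c
...   | yes τy<c = ⊥-elim (first y z≤n y<x (subst (IsArc y) τ′y≡τy arc-y))
  where
  τ′y≡τy : entry (delete τ i c) y ≡ entry τ y
  τ′y≡τy = trans (entry-delete-before τ i c y y<x) (ψ-below τy<c)
...   | no τy≮c = above (entry τ y) c<τy τ′y≡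
  where
  c<τy : c < entry τ y
  c<τy = ≤∧≢⇒< (≮⇒≥ τy≮c) (λ c≡τy → <-irrefl (injective y (toℕ i) (<-trans y<x (FinP.toℕ<n i)) (FinP.toℕ<n i)
                                                  (trans (sym c≡τy) (sym τi≡c))) y<x)
  τ′y≡ : entry (delete τ i c) y ≡ ψ c (entry τ y)
  τ′y≡ = entry-delete-before τ i c y y<x
  above : ∀ u → c < u → entry (delete τ i c) y ≡ ψ c u → toℕ i + c ≤ suc (y + entry (delete τ i c) y)
  above (suc w) (s≤s c≤w) τ′y≡ψ = subst (λ v → toℕ i + c ≤ suc (y + v)) (sym τ′y≡w)
    (+-mono-≤ (≤-trans (arc-≥ arc) (≤-trans c≤w (arc-≤ (subst (IsArc y) τ′y≡w arc-y)))) c≤w)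
    where
    τ′y≡w : entry (delete τ i c) y ≡ w
    τ′y≡w = trans τ′y≡ψ (ψ-above (m≤n⇒m≤1+n c≤w))

-- Deleting the first arc (x, c) of τ yields a parent with more than x + c
-- slots, so τ is one of its children.
slots-after-first-deletion : ∀ {k} (τ : Vec ℕ (suc k)) i c → IsPermℕ τ → entry τ (toℕ i) ≡ c → IsArc (toℕ i) c →
  NoArcBetween (entry τ) 0 (toℕ i) → toℕ i + c < slots (delete τ i c)
slots-after-first-deletion {k} τ i c perm τi≡c arc first =
  scan-lower-bound (entry (delete τ i c)) 0 k (suc (k + k)) (suc (toℕ i + c)) below-default
    (λ y _ _ arc-y → subst (suc (toℕ i + c) ≤_) (sym (+-comm _ 2))
       (s≤s (arc-after-first-deletion τ i c perm τi≡c arc first y arc-y)))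
  where
  c<k : c < suc k
  c<k = subst (_< suc k) τi≡c (proj₁ perm (toℕ i) (FinP.toℕ<n i))
  below-default : suc (toℕ i + c) ≤ suc (k + k)
  below-default = s≤s (+-mono-≤ (≤-pred (FinP.toℕ<n i)) (≤-pred c<k))

-- The generating tree.

unique-map : ∀ {A B : Set} (f : A → B) xs → Unique xs →
  (∀ {x y} → x ∈ xs → y ∈ xs → f x ≡ f y → x ≡ y) → Unique (map f xs)
unique-map f []       []                 _ = []
unique-map f (x ∷ xs) (x∉xs ∷ unique-xs) f-inj =
  All.tabulate (λ fx′∈ fx≡fx′ → let (x′ , x′∈xs , ≡) = ∈-map⁻ f fx′∈ in
                 All.lookup x∉xs x′∈xs (f-inj (here refl) (there x′∈xs) (trans fx≡fx′ ≡)))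
  ∷ unique-map f xs unique-xs (λ x∈ y∈ → f-inj (there x∈) (there y∈))

unique-concatMap : ∀ {A B : Set} (f : A → List B) xs → Unique xs → (∀ {x} → x ∈ xs → Unique (f x)) →
  (∀ {x x′ z} → x ∈ xs → x′ ∈ xs → z ∈ f x → z ∈ f x′ → x ≡ x′) → Unique (concatMap f xs)
unique-concatMap f []       []                 _        _        = []
unique-concatMap f (x ∷ xs) (x∉xs ∷ unique-xs) unique-f disjoint =
  ++⁺ (unique-f (here refl)) (unique-concatMap f xs unique-xs (λ x∈ → unique-f (there x∈)) (λ x∈ x′∈ → disjoint (there x∈) (there x′∈)))
      apart
  where
  apart : ∀ {z} → ¬ (z ∈ f x × z ∈ concatMap f xs)
  apart (z∈fx , z∈rest) with find (∈-concatMap⁻ f z∈rest)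
  ... | x′ , x′∈xs , z∈fx′ = All.lookup x∉xs x′∈xs (disjoint (here refl) (there x′∈xs) z∈fx z∈fx′)

children : ∀ {k} → Vec ℕ k → List (Vec ℕ (suc k))
children τ = map (insertSlot τ) (upTo (slots τ))

tree : ∀ {m} → Vec ℕ m → (n : ℕ) → List (Vec ℕ (n + m))
tree π zero    = π ∷ []
tree π (suc n) = concatMap children (tree π n)

child-step : ∀ {k} (τ : Vec ℕ k) g → IsPermℕ τ → g < slots τ → IsPermℕ (insertSlot τ g) × Step (insertSlot τ g) τ
child-step {k} τ g perm g<slots =
  perm⁺ , subst (Step (insert τ i c)) (delete-insert τ i c) (arc-deletion⇒step (insert τ i c) i c perm⁺ (entry-insert-here τ i c) arc)
  where
  i = proj₁ (decodeArc k g)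
  c = proj₂ (decodeArc k g)
  sound = decodeArc-sound k g (slot-≤ τ perm g<slots)
  arc = proj₁ (proj₂ sound)
  perm⁺ = insert-perm τ i c perm (proj₂ (proj₂ sound))

child-injective : ∀ {k} (τ₁ τ₂ : Vec ℕ k) g₁ g₂ → IsPermℕ τ₁ → IsPermℕ τ₂ → g₁ < slots τ₁ → g₂ < slots τ₂ →
  insertSlot τ₁ g₁ ≡ insertSlot τ₂ g₂ → g₁ ≡ g₂ × τ₁ ≡ τ₂
child-injective {k} τ₁ τ₂ g₁ g₂ perm₁ perm₂ g₁< g₂< same-child with
  +-cancelʳ-≡ 2 g₁ g₂ (trans (sym (slots-insertSlot τ₁ g₁ g₁< (slot-≤ τ₁ perm₁ g₁<)))
                      (trans (cong slots same-child) (slots-insertSlot τ₂ g₂ g₂< (slot-≤ τ₂ perm₂ g₂<))))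
... | refl = refl , trans (sym (delete-insert τ₁ i c)) (trans (cong (λ σ → delete σ i c) same-child) (delete-insert τ₂ i c))
  where
  i = proj₁ (decodeArc k g₁)
  c = proj₂ (decodeArc k g₁)

first-arc-parent : ∀ {k} (τ : Vec ℕ (suc k)) → IsPermℕ τ → Σ (Fin (suc k)) (λ i → IsArc (toℕ i) (entry τ (toℕ i))) →
  Σ (Fin (suc k)) λ i → Σ ℕ λ c → entry τ (toℕ i) ≡ c × IsArc (toℕ i) c × τ ∈ children (delete τ i c)
first-arc-parent {k} τ perm (i₀ , arc₀) with scan-view (entry τ) 0 (suc k) (suc (suc k + suc k))
... | inj₁ (_ , none) = ⊥-elim (none (toℕ i₀) z≤n (FinP.toℕ<n i₀) arc₀)
... | inj₂ (x , _ , x<k , arc-x , first , _) =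
  i , c , τi≡c , arc , subst (_∈ children τ′) τ′-child (∈-map⁺ (insertSlot τ′) (∈-upTo⁺ slot<))
  where
  i = fromℕ< x<k
  i≡x : toℕ i ≡ x
  i≡x = FinP.toℕ-fromℕ< x<k
  c = entry τ x
  τi≡c : entry τ (toℕ i) ≡ c
  τi≡c = cong (entry τ) i≡x
  arc : IsArc (toℕ i) c
  arc = subst (λ z → IsArc z c) (sym i≡x) arc-x
  τ′ = delete τ i c
  slot< : toℕ i + c < slots τ′
  slot< = slots-after-first-deletion τ i c perm τi≡c arc (subst (NoArcBetween (entry τ) 0) (sym i≡x) first)
  decoded = decodeArc-complete k (toℕ i) c arc (≤-pred (proj₁ perm x x<k))
  τ′-child : insertSlot τ′ (toℕ i + c) ≡ τ
  τ′-child = trans (cong₂ (insert τ′) (FinP.toℕ-injective (proj₁ decoded)) (proj₂ decoded)) (insert-delete τ i c perm τi≡c)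

-- Counting with weights: a permutation with s children contributes
-- ballot r s, the number of its descendants r generations below.
weight : ∀ {k} → ℕ → List (Vec ℕ k) → ℕ
weight r τs = sum (map (λ τ → ballot r (slots τ)) τs)

length≡weight-0 : ∀ {k} (τs : List (Vec ℕ k)) → length τs ≡ weight 0 τs
length≡weight-0 []       = refl
length≡weight-0 (_ ∷ τs) = cong suc (length≡weight-0 τs)

weight-concatMap : ∀ {k} r (τs : List (Vec ℕ k)) → weight r (concatMap children τs) ≡ sum (map (λ τ → weight r (children τ)) τs)
weight-concatMap r []       = refl
weight-concatMap r (τ ∷ τs) = begin
  sum (map _ (children τ ++ concatMap children τs))                ≡⟨ cong sum (map-++ _ (children τ) _) ⟩
  sum (map _ (children τ) ++ map _ (concatMap children τs))        ≡⟨ sum-++ (map _ (children τ)) _ ⟩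
  weight r (children τ) + weight r (concatMap children τs)         ≡⟨ cong (weight r (children τ) +_) (weight-concatMap r τs) ⟩
  weight r (children τ) + sum (map (λ τ → weight r (children τ)) τs) ∎
  where open ≡-Reasoning

ballot-suc-as-sum : ∀ r s → sum (map (λ g → ballot r (g + 2)) (upTo s)) ≡ ballot (suc r) s
ballot-suc-as-sum r zero    = refl
ballot-suc-as-sum r (suc s) = begin
  sum (map h (upTo (suc s)))           ≡⟨ cong (λ gs → sum (map h gs)) (upTo-∷ʳ s) ⟨
  sum (map h (upTo s ∷ʳ s))            ≡⟨ cong sum (map-++ h (upTo s) (s ∷ [])) ⟩
  sum (map h (upTo s) ++ h s ∷ [])     ≡⟨ sum-++ (map h (upTo s)) (h s ∷ []) ⟩
  sum (map h (upTo s)) + (h s + 0)     ≡⟨ cong₂ _+_ (ballot-suc-as-sum r s) (trans (+-identityʳ (h s)) (cong (ballot r) (+-comm s 2))) ⟩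
  ballot (suc r) s + ballot r (suc (suc s)) ∎
  where
  open ≡-Reasoning
  h = λ g → ballot r (g + 2)

weight-children : ∀ {k} r (τ : Vec ℕ k) → IsPermℕ τ → weight r (children τ) ≡ ballot (suc r) (slots τ)
weight-children r τ perm = begin
  sum (map (λ σ → ballot r (slots σ)) (map (insertSlot τ) (upTo (slots τ))))  ≡⟨ cong sum (map-∘ (upTo (slots τ))) ⟨
  sum (map (λ g → ballot r (slots (insertSlot τ g))) (upTo (slots τ)))        ≡⟨ cong sum (map-cong-local (All.tabulate child-slots)) ⟩
  sum (map (λ g → ballot r (g + 2)) (upTo (slots τ)))                         ≡⟨ ballot-suc-as-sum r (slots τ) ⟩
  ballot (suc r) (slots τ)                                                    ∎
  where
  open ≡-Reasoning
  child-slots : ∀ {g} → g ∈ upTo (slots τ) → ballot r (slots (insertSlot τ g)) ≡ ballot r (g + 2)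
  child-slots g∈ = cong (ballot r) (slots-insertSlot τ _ (∈-upTo⁻ g∈) (slot-≤ τ perm (∈-upTo⁻ g∈)))

module GeneratingTree {m} (π : Vec ℕ m) (straight : Straight π) where

  sound : ∀ n (τ : Vec ℕ (n + m)) → τ ∈ tree π n → IsPermℕ τ × ReducesTo τ π
  sound zero    τ (here refl) = proj₁ straight , done
  sound (suc n) σ σ∈ with find (∈-concatMap⁻ children σ∈)
  ... | τ , τ∈ , σ∈children with ∈-map⁻ (insertSlot τ) σ∈children
  ...   | g , g∈ , refl with sound n τ τ∈
  ...     | perm , τ⇝π with child-step τ g perm (∈-upTo⁻ g∈)
  ...       | perm⁺ , step₁ = perm⁺ , step step₁ τ⇝π

  -- Every permutation reducing to π is found: by confluence its parent
  -- (delete its first arc) still reduces to π.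
  complete : ∀ n (τ : Vec ℕ (n + m)) → IsPermℕ τ → ReducesTo τ π → τ ∈ tree π n
  complete zero    τ _    τ⇝π = here (reduces-same-size τ⇝π)
  complete (suc n) τ perm τ⇝π with first-arc-parent τ perm (reduces-has-arc τ⇝π (m≤n+m m n))
  ... | i , c , τi≡c , arc , τ∈children =
    ∈-concatMap⁺ children (lose (complete n (delete τ i c) (delete-perm τ i c perm τi≡c)
                         (arc-deletion-reduces straight τ⇝π perm i c τi≡c arc))
                       τ∈children)

  unique : ∀ n → Unique (tree π n)
  unique zero    = All.[] ∷ []
  unique (suc n) = unique-concatMap children (tree π n) (unique n) unique-children disjoint-children
    where
    perm : ∀ {τ} → τ ∈ tree π n → IsPermℕ τ
    perm τ∈ = proj₁ (sound n _ τ∈)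
    unique-children : ∀ {τ} → τ ∈ tree π n → Unique (children τ)
    unique-children {τ} τ∈ = unique-map (insertSlot τ) (upTo (slots τ)) (upTo⁺ _) λ g₁∈ g₂∈ same →
      proj₁ (child-injective τ τ _ _ (perm τ∈) (perm τ∈) (∈-upTo⁻ g₁∈) (∈-upTo⁻ g₂∈) same)
    disjoint-children : ∀ {τ₁ τ₂ σ} → τ₁ ∈ tree π n → τ₂ ∈ tree π n → σ ∈ children τ₁ → σ ∈ children τ₂ → τ₁ ≡ τ₂
    disjoint-children {τ₁} {τ₂} τ₁∈ τ₂∈ σ∈₁ σ∈₂ with ∈-map⁻ (insertSlot τ₁) σ∈₁ | ∈-map⁻ (insertSlot τ₂) σ∈₂
    ... | g₁ , g₁∈ , refl | g₂ , g₂∈ , same =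
      proj₂ (child-injective τ₁ τ₂ g₁ g₂ (perm τ₁∈) (perm τ₂∈) (∈-upTo⁻ g₁∈) (∈-upTo⁻ g₂∈) same)

  weight-level : ∀ n r → weight r (tree π (suc n)) ≡ weight (suc r) (tree π n)
  weight-level n r = trans (weight-concatMap r (tree π n))
    (cong sum (map-cong-local (All.tabulate (λ τ∈ → weight-children r _ (proj₁ (sound n _ τ∈))))))

  weight-tree : ∀ n r → weight r (tree π n) ≡ ballot (n + r) (slots π) + 0
  weight-tree zero    r = refl
  weight-tree (suc n) r = trans (weight-level n r) (trans (weight-tree n (suc r)) (cong (λ j → ballot j (slots π) + 0) (+-suc n r)))

  count : ∀ n → length (tree π n) ≡ ballot n (suc (m + m))
  count n = begin
    length (tree π n)              ≡⟨ length≡weight-0 (tree π n) ⟩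
    weight 0 (tree π n)            ≡⟨ weight-tree n 0 ⟩
    ballot (n + 0) (slots π) + 0   ≡⟨ +-identityʳ _ ⟩
    ballot (n + 0) (slots π)       ≡⟨ cong₂ ballot (+-identityʳ n) (slots-straight π straight) ⟩
    ballot n (suc (m + m))         ∎
    where open ≡-Reasoning

reducible-count : ∀ m (π : Vec ℕ m) → IsStraightMenage π →
  ∀ n → HasCard {n + m} (λ τ → ReducesTo τ π) (ballot n (suc (m + m)))
reducible-count m π menage n = tree π n , unique n , members , count n
  where
  open GeneratingTree π (IsStraightMenage⇒Straight {π = π} menage)
  members : ∀ τ → (τ ∈ tree π n) ⇔ (IsPerm τ × ReducesTo τ π)
  members τ = mk⇔ (λ τ∈ → let (perm , τ⇝π) = sound n τ τ∈ in IsPermℕ⇒IsPerm {τ = τ} perm , τ⇝π)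
                  (λ (perm , τ⇝π) → complete n τ (IsPerm⇒IsPermℕ {τ = τ} perm) τ⇝π)

theorem9 : (m : ℕ) (π : Vec ℕ m) → IsStraightMenage π →
           (n : ℕ) → HasCard {m + n} (λ τ → ReducesTo τ π) (pow catalan (suc (2 * m)) n)
theorem9 m π menage n =
  subst (λ k → HasCard {k} (λ τ → ReducesTo τ π) (pow catalan (suc (2 * m)) n)) (+-comm n m)
    (subst (HasCard (λ τ → ReducesTo τ π)) ballot≡catalan-power (reducible-count m π menage n))
  where
  ballot≡catalan-power : ballot n (suc (m + m)) ≡ pow catalan (suc (2 * m)) n
  ballot≡catalan-power = sym (trans (pow-catalan (suc (2 * m)) n) (cong (λ j → ballot n (suc (m + j))) (+-identityʳ m)))
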